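{- Let $\mu$ be a degree-$D$ shift-symmetric pseudodistribution satisfying the axioms $\mathcal{A}_I$ for an affine unique games instance $I=(G,\Pi)$ over alphabet $\Sigma$. Then: (1) for all vertices $u,v$ and all $s\in\Sigma$, $\widetilde{\Pr}[X_v=s\mid X_u=0]=\widetilde{\Pr}[X_v-X_u=s]$; (2) for every polynomial $f(X)$ with $\deg f\le D-2$ such that $f(X)=f(X+t)$ for every global shift $t\in\Sigma$, and all $u,v,s$, $\tilde{\mathbb{E}}[f(X)\mid X_v-X_u=s]=\tilde{\mathbb{E}}[f(X)\mid X_u=0,X_v=s]$.
   Context: Affine unique games: graph $G=(V,E)$, additive group $\Sigma$, constraints $\pi_{u,v}(x)=x-a_{u,v}$. Axioms $\mathcal{A}_I$ on $\{X_{u,a}\}$: $X_{u,a}^2=X_{u,a}$, $X_{u,a}X_{u,b}=0$ ($a\ne b$), $\sum_aX_{u,a}=1$. A degree-$D$ pseudodistribution (pseudo-expectation $\tilde{\mathbb{E}}$): linear functional on polynomials of degree $\le D$ with $\tilde{\mathbb{E}}[1]=1$, $\tilde{\mathbb{E}}[s^2]\ge0$ for $\deg s\le D/2$, $\tilde{\mathbb{E}}[fq]=0$ for each axiom $q=0$ with $\deg(fq)\le D$. It is shift-symmetric if $\tilde{\mathbb{E}}[X_{u_1,a_1}\cdots X_{u_t,a_t}]=\tilde{\mathbb{E}}[X_{u_1,a_1-s}\cdots X_{u_t,a_t-s}]$ for all monomials of degree $\le D$ and all $s\in\Sigma$. The global shift $X+t$ is the assignment of variables $(X+t)_{u,a}=X_{u,a-t}$.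 Indicators: $\mathbb{1}(X_v=s)=X_{v,s}$, $\mathbb{1}(X_v-X_u=s)=\sum_aX_{u,a}X_{v,a+s}$. $\widetilde{\Pr}[\mathcal{E}]=\tilde{\mathbb{E}}[\mathbb{1}(\mathcal{E})]$ and $\tilde{\mathbb{E}}[f\mid\mathcal{F}]=\tilde{\mathbb{E}}[f\mathbb{1}(\mathcal{F})]/\widetilde{\Pr}[\mathcal{F}]$ ($0$ if $\widetilde{\Pr}[\mathcal{F}]=0$); $\widetilde{\Pr}[\mathcal{E}\mid\mathcal{F}]=\tilde{\mathbb{E}}[\mathbb{1}(\mathcal{E})\mid\mathcal{F}]$. -}

module Defs where

open import Level using (0ℓ)
open import Data.Nat as ℕ using (ℕ; _≤_; _⊔_) renaming (_+_ to _+ℕ_; _*_ to _*ℕ_)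
open import Data.Fin using (Fin; _≟_)
open import Data.Fin.Properties using (all?)
open import Data.Product using (_×_; _,_; proj₁; proj₂)
open import Data.Product.Properties using (≡-dec)
open import Data.List using (List; []; _∷_; _++_; map; concatMap; filter; length; foldr; allFin)
open import Relation.Nullary using (¬_; Dec; yes; no)
open import Relation.Binary.PropositionalEquality using (_≡_; _≢_)
open import Relation.Binary.Structures using (IsTotalOrder)
open import Algebra.Structures using (IsCommutativeRing; IsAbelianGroup)

-- Scalars: an ordered field (e.g. ℝ).  The inverse is total with the
-- convention 0⁻¹ = 0, which implements "conditional expectation is 0
-- when the conditioning event has pseudo-probability 0".

record OrderedField : Set₁ where
  infixl 6 _+_
  infixl 7 _*_
  field
    K   : Set
    _+_ _*_ : K → K → K
    -_  : K → K
    0# 1# : K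
    _⁻¹ : K → K
    _≤K_ : K → K → Set
    isCommutativeRing : IsCommutativeRing _≡_ _+_ _*_ -_ 0# 1#
    0≢1      : 0# ≢ 1#
    inv-zero : 0# ⁻¹ ≡ 0#
    inv-right : ∀ x → x ≢ 0# → x * (x ⁻¹) ≡ 1#
    isTotalOrder : IsTotalOrder _≡_ _≤K_
    +-mono-≤ : ∀ {x y} z → x ≤K y → (x + z) ≤K (y + z)
    *-nonneg : ∀ {x y} → 0# ≤K x → 0# ≤K y → 0# ≤K (x * y)

record FiniteAbelianGroup : Set where
  field
    q    : ℕ
    _⊕_  : Fin q → Fin q → Fin q
    zeroΣ : Fin q
    ⊖_   : Fin q → Fin q
    isAbelianGroup : IsAbelianGroup _≡_ _⊕_ zeroΣ ⊖_

  _⊝_ : Fin q → Fin q → Fin q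
  a ⊝ b = a ⊕ (⊖ b)

-- Affine unique games instance on vertex set Fin n:
-- edges (u,v) with constraint π_{u,v}(x) = x - a_{u,v}.

record AffineUG (Σg : FiniteAbelianGroup) (n : ℕ) : Set where
  open FiniteAbelianGroup Σg
  field
    edges : List (Fin n × Fin n)
    shiftOf : Fin n → Fin n → Fin q

module UG (F : OrderedField) (Σg : FiniteAbelianGroup) (n : ℕ) where
  open OrderedField F
  open FiniteAbelianGroup Σg

  Var : Set
  Var = Fin n × Fin q

  _≟V_ : (x y : Var) → Dec (x ≡ y)
  _≟V_ = ≡-dec _≟_ _≟_

  Monomial : Set
  Monomial = List Var

  mult : Var → Monomial → ℕ
  mult x m = length (filter (x ≟V_) m)

  SameMonomial : Monomial → Monomial → Set
  SameMonomial m m' = ∀ (u : Fin n) (a : Fin q) → mult (u , a) m ≡ mult (u , a) m'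

  sameMonomial? : ∀ m m' → Dec (SameMonomial m m')
  sameMonomial? m m' = all? (λ u → all? (λ a → mult (u , a) m ℕ.≟ mult (u , a) m'))

  Poly : Set
  Poly = List (K × Monomial)

  sumK : List K → K
  sumK = foldr _+_ 0#

  coeff : Poly → Monomial → K
  coeff p m = sumK (map proj₁ (filter (λ t → sameMonomial? (proj₂ t) m) p))

  _≈P_ : Poly → Poly → Set
  p ≈P p' = ∀ m → coeff p m ≡ coeff p' m

  deg : Poly → ℕ
  deg p = foldr (λ t d → length (proj₂ t) ⊔ d) 0 p

  constP : K → Poly
  constP c = (c , []) ∷ []

  1P : Poly
  1P = constP 1#

  _+P_ : Poly → Poly → Poly
  p +P p' = p ++ p'

  -P_ : Poly → Poly
  -P p = map (λ t → (- proj₁ t , proj₂ t)) p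

  _*P_ : Poly → Poly → Poly
  p *P p' = concatMap (λ t → map (λ t' → (proj₁ t * proj₁ t' , proj₂ t ++ proj₂ t')) p') p

  sumP : List Poly → Poly
  sumP = foldr _+P_ []

  var : Fin n → Fin q → Poly
  var u a = (1# , (u , a) ∷ []) ∷ []

  -- global shift:  f(X + t), where (X+t)_{u,a} = X_{u,a-t}
  shiftMono : Fin q → Monomial → Monomial
  shiftMono t m = map (λ x → (proj₁ x , proj₂ x ⊝ t)) m

  shiftP : Fin q → Poly → Poly
  shiftP t p = map (λ c → (proj₁ c , shiftMono t (proj₂ c))) p

  -- the axioms A_I, as polynomials q with constraint q = 0
  data Axiom : Poly → Set where
    booleanity : ∀ u a → Axiom ((var u a *P var u a) +P (-P var u a))
    disjoint   : ∀ u a b → a ≢ b → Axiom (var u a *P var u b)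
    complete   : ∀ u → Axiom (sumP (map (var u) (allFin q)) +P (-P 1P))

  -- A degree-D pseudo-expectation, given by its values on monomials
  -- (extended linearly to polynomials); values on monomials of degree > D
  -- are irrelevant junk.
  record PseudoExpectation (D : ℕ) : Set where
    field
      moment : Monomial → K
      -- well-defined on the commutative polynomial ring
      moment-comm : ∀ m m' → length m ≤ D → SameMonomial m m' → moment m ≡ moment m'

    Ẽ : Poly → K
    Ẽ p = sumK (map (λ t → proj₁ t * moment (proj₂ t)) p)

    field
      normalized : Ẽ 1P ≡ 1#
      positive   : ∀ s → deg s +ℕ deg s ≤ D → 0# ≤K Ẽ (s *P s)
      satisfies  : ∀ {ax} → Axiom ax → ∀ f → deg (f *P ax) ≤ D → Ẽ (f *P ax) ≡ 0#

  ShiftSymmetric : ∀ {D} → PseudoExpectation D → Set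
  ShiftSymmetric {D} μ = ∀ (m : Monomial) (s : Fin q) → length m ≤ D →
    PseudoExpectation.moment μ m ≡ PseudoExpectation.moment μ (shiftMono s m)

  -- indicators:  ind v s = 1(X_v = s),  indDiff v u s = 1(X_v - X_u = s)
  ind : Fin n → Fin q → Poly
  ind v s = var v s

  indDiff : Fin n → Fin n → Fin q → Poly
  indDiff v u s = sumP (map (λ a → var u a *P var v (a ⊕ s)) (allFin q))

  module _ {D : ℕ} (μ : PseudoExpectation D) where
    open PseudoExpectation μ

    Pr : Poly → K
    Pr e = Ẽ e

    -- Ẽ[f | F] = Ẽ[f 1(F)] / Pr[F]   (0 if Pr[F] = 0)
    Ẽ[_∣_] : Poly → Poly → K
    Ẽ[ f ∣ e ] = Ẽ (f *P e) * (Pr e ⁻¹)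

    Pr[_∣_] : Poly → Poly → K
    Pr[ e ∣ e' ] = Ẽ[ e ∣ e' ]

-- Shift symmetry makes all marginals Ẽ[X_{u,a}] equal, so by the axiom Σ_a X_{u,a} = 1 each is 1/|Σ|.
-- It also moves each term f·X_{u,a}·X_{v,a+s} of f·1(X_v − X_u = s) to f(X − a)·X_{u,0}·X_{v,s}, which
-- for shift-invariant f has the same pseudo-expectation as f·X_{u,0}·X_{v,s}, because Ẽ depends only on
-- the coefficients of polynomials of degree at most D.  Hence Ẽ[f·1(X_v − X_u = s)] = |Σ|·Ẽ[f·X_{u,0}·X_{v,s}]
-- (with f = 1 this computes Pr[X_v − X_u = s]), and the factor |Σ| cancels in both conditional expectations.

module Submission where

open import Defs
open import Level using (0ℓ)
open import Function using (_∘_)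
open import Data.Nat using (ℕ; suc; _≤_; z≤n; s≤s) renaming (_+_ to _+ℕ_)
import Data.Nat.Properties as ℕ
open import Data.Fin using (Fin)
open import Data.Product using (_×_; _,_; proj₁; proj₂)
open import Data.Sum using (inj₁; inj₂)
open import Data.Bool using (true; false)
open import Data.List using ([]; _∷_; _++_; map; concatMap; filter; length; allFin)
import Data.List.Properties as List
open import Data.List.Relation.Unary.All as All using (All; []; _∷_)
open import Data.List.Relation.Unary.All.Properties using (map⁺; ++⁺; concat⁺; all-filter; filter⁺)
open import Relation.Nullary using (¬_; Dec; yes; no; does; contradiction)
open import Relation.Unary using (Decidable)
open import Relation.Unary.Properties using (∁?)
open import Relation.Binary.PropositionalEquality
open ≡-Reasoning
open import Relation.Binary.Structures using (IsTotalOrder)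
open import Algebra.Bundles using (CommutativeRing; AbelianGroup)
import Algebra.Properties.CommutativeSemigroup as CommutativeSemigroupProperties
import Algebra.Properties.Group as GroupProperties
import Algebra.Properties.AbelianGroup as AbelianGroupProperties
import Algebra.Properties.Ring as RingProperties

filter-∁-disjoint : {A : Set} {P Q : A → Set} (P? : Decidable P) (Q? : Decidable Q) →
  (∀ {x} → Q x → ¬ P x) → ∀ xs → filter Q? (filter (∁? P?) xs) ≡ filter Q? xs
filter-∁-disjoint P? Q? Q⇒¬P [] = refl
filter-∁-disjoint {P = P} {Q} P? Q? Q⇒¬P (x ∷ xs) = by-cases (Q? x)
  where
  IH : filter Q? (filter (∁? P?) xs) ≡ filter Q? xs
  IH = filter-∁-disjoint P? Q? Q⇒¬P xs
  by-cases : Dec (Q x) → filter Q? (filter (∁? P?) (x ∷ xs)) ≡ filter Q? (x ∷ xs)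
  by-cases (yes qx) = begin
    filter Q? (filter (∁? P?) (x ∷ xs))  ≡⟨ cong (filter Q?) (List.filter-accept (∁? P?) (Q⇒¬P qx)) ⟩
    filter Q? (x ∷ filter (∁? P?) xs)    ≡⟨ List.filter-accept Q? qx ⟩
    x ∷ filter Q? (filter (∁? P?) xs)    ≡⟨ cong (x ∷_) IH ⟩
    x ∷ filter Q? xs                     ≡⟨ List.filter-accept Q? qx ⟨
    filter Q? (x ∷ xs)                   ∎
  by-cases (no ¬qx) = begin
    filter Q? (filter (∁? P?) (x ∷ xs))  ≡⟨ head-dropped (P? x) ⟩
    filter Q? (filter (∁? P?) xs)        ≡⟨ IH ⟩
    filter Q? xs                         ≡⟨ List.filter-reject Q? ¬qx ⟨
    filter Q? (x ∷ xs)                   ∎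
    where
    head-dropped : Dec (P x) → filter Q? (filter (∁? P?) (x ∷ xs)) ≡ filter Q? (filter (∁? P?) xs)
    head-dropped (yes px) = cong (filter Q?) (List.filter-reject (∁? P?) (λ ¬px → ¬px px))
    head-dropped (no ¬px) =
      trans (cong (filter Q?) (List.filter-accept (∁? P?) ¬px)) (List.filter-reject Q? ¬qx)

module _ (F : OrderedField) where
  open OrderedField F

  private
    ring : CommutativeRing 0ℓ 0ℓ
    ring = record { isCommutativeRing = isCommutativeRing }

  open CommutativeRing ring
    using (+-assoc; +-identityˡ; +-identityʳ; *-assoc; *-comm; *-identityˡ;
           distribʳ; zeroˡ; zeroʳ; +-commutativeSemigroup; *-commutativeSemigroup;
           +-abelianGroup; +-group)
  open CommutativeSemigroupProperties +-commutativeSemigroup using (x∙yz≈y∙xz) renaming (interchange to +-interchange)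
  open CommutativeSemigroupProperties *-commutativeSemigroup using (interchange)
  open GroupProperties +-group using (ε⁻¹≈ε; x∙y⁻¹≈ε⇒x≈y)
  open AbelianGroupProperties +-abelianGroup using (⁻¹-∙-comm)
  open RingProperties (CommutativeRing.ring ring) using (-‿distribˡ-*)
  open IsTotalOrder isTotalOrder using (total; antisym)

  -- If x ≡ y the two comparisons are the same call, so they cannot disagree.
  _≟K_ : (x y : K) → Dec (x ≡ y)
  x ≟K y with total x y in x∼y | total y x in y∼x
  ... | inj₁ x≤y | inj₁ y≤x = yes (antisym x≤y y≤x)
  ... | inj₂ y≤x | inj₂ x≤y = yes (antisym x≤y y≤x)
  ... | inj₁ _   | inj₂ _   = no λ { refl → contradiction (trans (sym x∼y) y∼x) λ () }
  ... | inj₂ _   | inj₁ _   = no λ { refl → contradiction (trans (sym x∼y) y∼x) λ () }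

  ⁻¹-unique : ∀ {x y} → x * y ≡ 1# → x ⁻¹ ≡ y
  ⁻¹-unique {x} {y} xy≡1 = begin
    x ⁻¹                ≡⟨ *-identityˡ (x ⁻¹) ⟨
    1# * x ⁻¹           ≡⟨ cong (_* x ⁻¹) xy≡1 ⟨
    (x * y) * x ⁻¹      ≡⟨ *-assoc x y (x ⁻¹) ⟩
    x * (y * x ⁻¹)      ≡⟨ cong (x *_) (*-comm y (x ⁻¹)) ⟩
    x * (x ⁻¹ * y)      ≡⟨ *-assoc x (x ⁻¹) y ⟨
    (x * x ⁻¹) * y      ≡⟨ cong (_* y) (inv-right x x≢0) ⟩
    1# * y              ≡⟨ *-identityˡ y ⟩
    y                   ∎
    where
    x≢0 : x ≢ 0#
    x≢0 refl = 0≢1 (trans (sym (zeroˡ y)) xy≡1)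

  ratio-cancelˡ : ∀ {c c′} x y → c * c′ ≡ 1# → (c * x) * (c * y) ⁻¹ ≡ x * y ⁻¹
  ratio-cancelˡ {c} {c′} x y cc′≡1 with y ≟K 0#
  ... | yes refl = begin
    (c * x) * (c * 0#) ⁻¹   ≡⟨ cong (λ z → (c * x) * z ⁻¹) (zeroʳ c) ⟩
    (c * x) * 0# ⁻¹         ≡⟨ cong ((c * x) *_) inv-zero ⟩
    (c * x) * 0#            ≡⟨ zeroʳ (c * x) ⟩
    0#                      ≡⟨ zeroʳ x ⟨
    x * 0#                  ≡⟨ cong (x *_) inv-zero ⟨
    x * 0# ⁻¹               ∎
  ... | no y≢0 = begin
    (c * x) * (c * y) ⁻¹     ≡⟨ cong ((c * x) *_) (⁻¹-unique cy*c′y⁻¹≡1) ⟩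
    (c * x) * (c′ * y ⁻¹)    ≡⟨ interchange c x c′ (y ⁻¹) ⟩
    (c * c′) * (x * y ⁻¹)    ≡⟨ cong (_* (x * y ⁻¹)) cc′≡1 ⟩
    1# * (x * y ⁻¹)          ≡⟨ *-identityˡ (x * y ⁻¹) ⟩
    x * y ⁻¹                 ∎
    where
    cy*c′y⁻¹≡1 : (c * y) * (c′ * y ⁻¹) ≡ 1#
    cy*c′y⁻¹≡1 = begin
      (c * y) * (c′ * y ⁻¹)  ≡⟨ interchange c y c′ (y ⁻¹) ⟩
      (c * c′) * (y * y ⁻¹)  ≡⟨ cong₂ _*_ cc′≡1 (inv-right y y≢0) ⟩
      1# * 1#                ≡⟨ *-identityˡ 1# ⟩
      1#                     ∎

  module _ (Σg : FiniteAbelianGroup) (n : ℕ) where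
    open FiniteAbelianGroup Σg
    open UG F Σg n

    private
      Σ-abelianGroup : AbelianGroup 0ℓ 0ℓ
      Σ-abelianGroup = record { isAbelianGroup = isAbelianGroup }
    open AbelianGroup Σ-abelianGroup using (inverseʳ)
    open AbelianGroupProperties Σ-abelianGroup using (xyx⁻¹≈y)

    sumK-++ : ∀ xs ys → sumK (xs ++ ys) ≡ sumK xs + sumK ys
    sumK-++ []       ys = sym (+-identityˡ (sumK ys))
    sumK-++ (x ∷ xs) ys = trans (cong (x +_) (sumK-++ xs ys)) (sym (+-assoc x (sumK xs) (sumK ys)))

    sumK-partition : {A : Set} {P : A → Set} (P? : Decidable P) (w : A → K) → ∀ xs →
      sumK (map w xs) ≡ sumK (map w (filter P? xs)) + sumK (map w (filter (∁? P?) xs))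
    sumK-partition P? w []       = sym (+-identityˡ 0#)
    sumK-partition P? w (x ∷ xs) with does (P? x)
    ... | true  = trans (cong (w x +_) (sumK-partition P? w xs)) (sym (+-assoc _ _ _))
    ... | false = trans (cong (w x +_) (sumK-partition P? w xs)) (x∙yz≈y∙xz _ _ _)

    sumK-const : {A : Set} {h : A → K} {x : K} → (∀ a → h a ≡ x) → ∀ as →
      sumK (map h as) ≡ sumK (map (λ _ → 1#) as) * x
    sumK-const h≡x []       = sym (zeroˡ _)
    sumK-const {x = x} h≡x (a ∷ as) = begin
      _ + sumK (map _ as)              ≡⟨ cong₂ _+_ (trans (h≡x a) (sym (*-identityˡ x))) (sumK-const h≡x as) ⟩
      1# * x + sumK (map _ as) * x     ≡⟨ distribʳ x 1# _ ⟨
      (1# + sumK (map _ as)) * x       ∎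

    ∣Σ∣ : K
    ∣Σ∣ = sumK (map (λ _ → 1#) (allFin q))

    linExt : (Monomial → K) → Poly → K
    linExt φ p = sumK (map (λ t → proj₁ t * φ (proj₂ t)) p)

    linExt-++ : ∀ φ p p′ → linExt φ (p ++ p′) ≡ linExt φ p + linExt φ p′
    linExt-++ φ p p′ = trans (cong sumK (List.map-++ w p p′)) (sumK-++ (map w p) (map w p′))
      where
      w : K × Monomial → K
      w t = proj₁ t * φ (proj₂ t)

    linExt-negate : ∀ φ p → linExt φ (-P p) ≡ - linExt φ p
    linExt-negate φ []            = sym ε⁻¹≈ε
    linExt-negate φ ((c , m) ∷ p) =
      trans (cong₂ _+_ (sym (-‿distribˡ-* c (φ m))) (linExt-negate φ p)) (⁻¹-∙-comm _ _)

    linExt-1P*P : ∀ φ p → linExt φ (1P *P p) ≡ linExt φ p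
    linExt-1P*P φ p = trans (linExt-++ φ 1·p []) (trans (+-identityʳ (linExt φ 1·p)) (unit p))
      where
      1·p : Poly
      1·p = map (λ t → (1# * proj₁ t , [] ++ proj₂ t)) p
      unit : ∀ p → linExt φ (map (λ t → (1# * proj₁ t , [] ++ proj₂ t)) p) ≡ linExt φ p
      unit []            = refl
      unit ((c , m) ∷ p) = cong₂ _+_ (cong (_* φ m) (*-identityˡ c)) (unit p)

    linExt-sumP : ∀ φ {A : Set} (h : A → Poly) as → linExt φ (sumP (map h as)) ≡ sumK (map (linExt φ ∘ h) as)
    linExt-sumP φ h []       = refl
    linExt-sumP φ h (a ∷ as) = trans (linExt-++ φ (h a) _) (cong (_ +_) (linExt-sumP φ h as))

    linExt-shiftP : ∀ φ t p → linExt φ (shiftP t p) ≡ linExt (φ ∘ shiftMono t) p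
    linExt-shiftP φ t p = cong sumK (sym (List.map-∘ p))

    linExt-*P-term : ∀ φ k mm p → linExt φ (p *P ((k , mm) ∷ [])) ≡ linExt (λ m → k * φ (m ++ mm)) p
    linExt-*P-term φ k mm []            = refl
    linExt-*P-term φ k mm ((c , m) ∷ p) = cong₂ _+_ (*-assoc c k _) (linExt-*P-term φ k mm p)

    linExt-*P-++ʳ : ∀ φ p p₁ p₂ → linExt φ (p *P (p₁ ++ p₂)) ≡ linExt φ (p *P p₁) + linExt φ (p *P p₂)
    linExt-*P-++ʳ φ []      p₁ p₂ = sym (+-identityˡ 0#)
    linExt-*P-++ʳ φ (t ∷ p) p₁ p₂ = begin
      linExt φ (t·(p₁ ++ p₂) ++ p *P (p₁ ++ p₂))
        ≡⟨ linExt-++ φ (t·(p₁ ++ p₂)) _ ⟩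
      linExt φ (t·(p₁ ++ p₂)) + linExt φ (p *P (p₁ ++ p₂))
        ≡⟨ cong₂ _+_ (trans (cong (linExt φ) (List.map-++ _ p₁ p₂)) (linExt-++ φ (t· p₁) (t· p₂)))
                     (linExt-*P-++ʳ φ p p₁ p₂) ⟩
      (linExt φ (t· p₁) + linExt φ (t· p₂)) + (linExt φ (p *P p₁) + linExt φ (p *P p₂))
        ≡⟨ +-interchange _ _ _ _ ⟩
      (linExt φ (t· p₁) + linExt φ (p *P p₁)) + (linExt φ (t· p₂) + linExt φ (p *P p₂))
        ≡⟨ cong₂ _+_ (linExt-++ φ (t· p₁) _) (linExt-++ φ (t· p₂) _) ⟨
      linExt φ (t· p₁ ++ p *P p₁) + linExt φ (t· p₂ ++ p *P p₂)
        ∎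
      where
      t·_ : Poly → Poly
      t· p′ = map (λ t′ → (proj₁ t * proj₁ t′ , proj₂ t ++ proj₂ t′)) p′

    linExt-*P-sumP : ∀ φ p {A : Set} (h : A → Poly) as →
      linExt φ (p *P sumP (map h as)) ≡ sumK (map (λ a → linExt φ (p *P h a)) as)
    linExt-*P-sumP φ p h []       = zero-product p
      where
      zero-product : ∀ p → linExt φ (p *P []) ≡ 0#
      zero-product []      = refl
      zero-product (_ ∷ p) = zero-product p
    linExt-*P-sumP φ p h (a ∷ as) =
      trans (linExt-*P-++ʳ φ p (h a) _) (cong (_ +_) (linExt-*P-sumP φ p h as))

    Bounded : ℕ → Poly → Set
    Bounded B = All (λ t → length (proj₂ t) ≤ B)

    deg≤⇒Bounded : ∀ {B} p → deg p ≤ B → Bounded B p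
    deg≤⇒Bounded []      _   = []
    deg≤⇒Bounded (t ∷ p) deg≤B =
      ℕ.≤-trans (ℕ.m≤m⊔n _ _) deg≤B ∷ deg≤⇒Bounded p (ℕ.≤-trans (ℕ.m≤n⊔m _ _) deg≤B)

    Bounded⇒deg≤ : ∀ {B p} → Bounded B p → deg p ≤ B
    Bounded⇒deg≤ []       = z≤n
    Bounded⇒deg≤ (b ∷ bs) = ℕ.⊔-lub b (Bounded⇒deg≤ bs)

    Bounded-mono : ∀ {B B′ p} → B ≤ B′ → Bounded B p → Bounded B′ p
    Bounded-mono B≤B′ = All.map (λ len≤B → ℕ.≤-trans len≤B B≤B′)

    Bounded-var : ∀ u a → Bounded 1 (var u a)
    Bounded-var u a = s≤s z≤n ∷ []

    Bounded-*P : ∀ {B B′ p p′} → Bounded B p → Bounded B′ p′ → Bounded (B +ℕ B′) (p *P p′)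
    Bounded-*P bp bp′ = concat⁺ (map⁺ (All.map (λ {t} len≤B → map⁺ (All.map (λ len′≤B′ →
      ℕ.≤-trans (ℕ.≤-reflexive (List.length-++ (proj₂ t))) (ℕ.+-mono-≤ len≤B len′≤B′)) bp′)) bp))

    Bounded-shiftP : ∀ {B p} t → Bounded B p → Bounded B (shiftP t p)
    Bounded-shiftP t = map⁺ ∘ All.map (λ {t′} len≤B →
      ℕ.≤-trans (ℕ.≤-reflexive (List.length-map (λ x → (proj₁ x , proj₂ x ⊝ t)) (proj₂ t′))) len≤B)

    Bounded-sumP : ∀ {B} {A : Set} {h : A → Poly} → (∀ a → Bounded B (h a)) → ∀ as → Bounded B (sumP (map h as))
    Bounded-sumP bh []       = []
    Bounded-sumP bh (a ∷ as) = ++⁺ (bh a) (Bounded-sumP bh as)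

    linExt-cong : ∀ {B φ ψ p} → (∀ {m} → length m ≤ B → φ m ≡ ψ m) → Bounded B p → linExt φ p ≡ linExt ψ p
    linExt-cong φ≡ψ []       = refl
    linExt-cong φ≡ψ (b ∷ bs) = cong₂ _+_ (cong (_ *_) (φ≡ψ b)) (linExt-cong φ≡ψ bs)

    mult-++ : ∀ x m m′ → mult x (m ++ m′) ≡ mult x m +ℕ mult x m′
    mult-++ x m m′ = trans (cong length (List.filter-++ (x ≟V_) m m′)) (List.length-++ (filter (x ≟V_) m))

    SameMonomial-++ʳ : ∀ {m m′} mm → SameMonomial m m′ → SameMonomial (m ++ mm) (m′ ++ mm)
    SameMonomial-++ʳ {m} {m′} mm m~m′ u a = begin
      mult (u , a) (m ++ mm)               ≡⟨ mult-++ (u , a) m mm ⟩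
      mult (u , a) m +ℕ mult (u , a) mm    ≡⟨ cong (_+ℕ mult (u , a) mm) (m~m′ u a) ⟩
      mult (u , a) m′ +ℕ mult (u , a) mm   ≡⟨ mult-++ (u , a) m′ mm ⟨
      mult (u , a) (m′ ++ mm)              ∎

    SameMonomial-++-comm : ∀ m m′ → SameMonomial (m ++ m′) (m′ ++ m)
    SameMonomial-++-comm m m′ u a =
      trans (mult-++ (u , a) m m′) (trans (ℕ.+-comm (mult (u , a) m) (mult (u , a) m′)) (sym (mult-++ (u , a) m′ m)))

    termOf? : (m : Monomial) → Decidable (λ (t : K × Monomial) → SameMonomial (proj₂ t) m)
    termOf? m t = sameMonomial? (proj₂ t) m

    dropMonomial : Monomial → Poly → Poly
    dropMonomial m = filter (∁? (termOf? m))

    coeff-drop-same : ∀ m m′ p → SameMonomial m′ m → coeff (dropMonomial m p) m′ ≡ 0#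
    coeff-drop-same m m′ p m′~m = cong (sumK ∘ map proj₁) (List.filter-none (termOf? m′)
      (All.map (λ ≁m ~m′ → ≁m (λ u a → trans (~m′ u a) (m′~m u a))) (all-filter (∁? (termOf? m)) p)))

    coeff-drop-other : ∀ m m′ p → ¬ SameMonomial m′ m → coeff (dropMonomial m p) m′ ≡ coeff p m′
    coeff-drop-other m m′ p m′≁m = cong (sumK ∘ map proj₁) (filter-∁-disjoint (termOf? m) (termOf? m′)
      (λ ~m′ ~m → m′≁m (λ u a → trans (sym (~m′ u a)) (~m u a))) p)

    drop-≈P : ∀ m {p p′} → p ≈P p′ → dropMonomial m p ≈P dropMonomial m p′
    drop-≈P m {p} {p′} p≈p′ m′ with sameMonomial? m′ m
    ... | yes m′~m = trans (coeff-drop-same m m′ p m′~m) (sym (coeff-drop-same m m′ p′ m′~m))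
    ... | no  m′≁m = trans (coeff-drop-other m m′ p m′≁m)
                       (trans (p≈p′ m′) (sym (coeff-drop-other m m′ p′ m′≁m)))

    length-drop-head : ∀ c m p → length (dropMonomial m ((c , m) ∷ p)) ≤ length p
    length-drop-head c m p = ℕ.≤-trans
      (ℕ.≤-reflexive (cong length (List.filter-reject (∁? (termOf? m)) (λ m≁m → m≁m (λ _ _ → refl)))))
      (List.length-filter (∁? (termOf? m)) p)

    RespectsSame : ℕ → (Monomial → K) → Set
    RespectsSame B φ = ∀ {m m′} → length m ≤ B → SameMonomial m m′ → φ m ≡ φ m′

    module _ {B φ} (φ-resp : RespectsSame B φ) where

      linExt-select : ∀ m {p} → Bounded B p → linExt φ (filter (termOf? m) p) ≡ coeff p m * φ m
      linExt-select m []                       = sym (zeroˡ (φ m))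
      linExt-select m {(c , m′) ∷ p} (b ∷ bs) = by-cases (termOf? m (c , m′))
        where
        coeff-of : Poly → K
        coeff-of ts = sumK (map proj₁ ts)
        by-cases : Dec (SameMonomial m′ m) →
          linExt φ (filter (termOf? m) ((c , m′) ∷ p)) ≡ coeff ((c , m′) ∷ p) m * φ m
        by-cases (yes m′~m) = begin
          linExt φ (filter (termOf? m) ((c , m′) ∷ p))  ≡⟨ cong (linExt φ) (List.filter-accept (termOf? m) m′~m) ⟩
          c * φ m′ + linExt φ (filter (termOf? m) p)    ≡⟨ cong₂ _+_ (cong (c *_) (φ-resp b m′~m)) (linExt-select m bs) ⟩
          c * φ m + coeff p m * φ m                     ≡⟨ distribʳ (φ m) c (coeff p m) ⟨
          (c + coeff p m) * φ m                         ≡⟨ cong (λ ts → coeff-of ts * φ m) (List.filter-accept (termOf? m) m′~m) ⟨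
          coeff ((c , m′) ∷ p) m * φ m                  ∎
        by-cases (no m′≁m) = begin
          linExt φ (filter (termOf? m) ((c , m′) ∷ p))  ≡⟨ cong (linExt φ) (List.filter-reject (termOf? m) m′≁m) ⟩
          linExt φ (filter (termOf? m) p)               ≡⟨ linExt-select m bs ⟩
          coeff p m * φ m                               ≡⟨ cong (λ ts → coeff-of ts * φ m) (List.filter-reject (termOf? m) m′≁m) ⟨
          coeff ((c , m′) ∷ p) m * φ m                  ∎

      linExt-split : ∀ m {p} → Bounded B p → linExt φ p ≡ coeff p m * φ m + linExt φ (dropMonomial m p)
      linExt-split m {p} bp =
        trans (sumK-partition (termOf? m) _ p) (cong (_+ linExt φ (dropMonomial m p)) (linExt-select m bp))

      -- Peel off, from both sides at once, all terms with the monomial of the first term.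
      linExt-resp-≈P : ∀ {p p′} → Bounded B p → Bounded B p′ → p ≈P p′ → linExt φ p ≡ linExt φ p′
      linExt-resp-≈P {p} {p′} = peel (length p +ℕ length p′) ℕ.≤-refl
        where
        peel-at : ∀ m {p p′} → Bounded B p → Bounded B p′ → p ≈P p′ →
          linExt φ (dropMonomial m p) ≡ linExt φ (dropMonomial m p′) → linExt φ p ≡ linExt φ p′
        peel-at m {p} {p′} bp bp′ p≈p′ rest≡ = begin
          linExt φ p                                              ≡⟨ linExt-split m bp ⟩
          coeff p m * φ m + linExt φ (dropMonomial m p)           ≡⟨ cong₂ (λ x y → x * φ m + y) (p≈p′ m) rest≡ ⟩
          coeff p′ m * φ m + linExt φ (dropMonomial m p′)         ≡⟨ linExt-split m bp′ ⟨
          linExt φ p′                                             ∎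

        peel : ∀ N {p p′} → length p +ℕ length p′ ≤ N →
          Bounded B p → Bounded B p′ → p ≈P p′ → linExt φ p ≡ linExt φ p′
        peel _ {[]} {[]} _ _ _ _ = refl
        peel (suc N) {(c , m) ∷ p} {p′} (s≤s len) bp bp′ p≈p′ =
          peel-at m bp bp′ p≈p′ (peel N
            (ℕ.≤-trans (ℕ.+-mono-≤ (length-drop-head c m p) (List.length-filter (∁? (termOf? m)) p′)) len)
            (filter⁺ (∁? (termOf? m)) bp) (filter⁺ (∁? (termOf? m)) bp′) (drop-≈P m {(c , m) ∷ p} {p′} p≈p′))
        peel (suc N) {[]} {(c , m) ∷ p′} (s≤s len) bp bp′ p≈p′ =
          peel-at m bp bp′ p≈p′ (peel N {[]}
            (ℕ.≤-trans (length-drop-head c m p′) len)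
            [] (filter⁺ (∁? (termOf? m)) bp′) (drop-≈P m {[]} {(c , m) ∷ p′} p≈p′))

    shiftP-*P : ∀ t p p′ → shiftP t (p *P p′) ≡ shiftP t p *P shiftP t p′
    shiftP-*P t p p′ = begin
      map s (concatMap (λ x → map (mul x) p′) p)          ≡⟨ List.map-concatMap s _ p ⟩
      concatMap (λ x → map s (map (mul x) p′)) p          ≡⟨ List.concatMap-cong shift-row p ⟩
      concatMap (λ x → map (mul (s x)) (map s p′)) p      ≡⟨ List.concatMap-map _ s p ⟨
      concatMap (λ y → map (mul y) (map s p′)) (map s p)  ∎
      where
      s : K × Monomial → K × Monomial
      s x = (proj₁ x , shiftMono t (proj₂ x))
      mul : K × Monomial → K × Monomial → K × Monomial
      mul x y = (proj₁ x * proj₁ y , proj₂ x ++ proj₂ y)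
      shift-row : ∀ x → map s (map (mul x) p′) ≡ map (mul (s x)) (map s p′)
      shift-row x = trans (sym (List.map-∘ p′)) (trans (List.map-cong (λ y →
        cong (proj₁ x * proj₁ y ,_) (List.map-++ _ (proj₂ x) (proj₂ y))) p′) (List.map-∘ p′))

    ShiftInvariant : Poly → Set
    ShiftInvariant f = ∀ t → f ≈P shiftP t f

    module _ {D : ℕ} (μ : PseudoExpectation D) where
      open PseudoExpectation μ

      Ẽ-*P-term-cong : ∀ {B g g′} k mm → B +ℕ length mm ≤ D → Bounded B g → Bounded B g′ → g ≈P g′ →
        Ẽ (g *P ((k , mm) ∷ [])) ≡ Ẽ (g′ *P ((k , mm) ∷ []))
      Ẽ-*P-term-cong {B} {g} {g′} k mm len≤D bg bg′ g≈g′ = begin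
        Ẽ (g *P ((k , mm) ∷ []))   ≡⟨ linExt-*P-term moment k mm g ⟩
        linExt ψ g                 ≡⟨ linExt-resp-≈P ψ-resp bg bg′ g≈g′ ⟩
        linExt ψ g′                ≡⟨ linExt-*P-term moment k mm g′ ⟨
        Ẽ (g′ *P ((k , mm) ∷ []))  ∎
        where
        ψ : Monomial → K
        ψ m = k * moment (m ++ mm)
        ψ-resp : RespectsSame B ψ
        ψ-resp {m} {m′} len≤B m~m′ = cong (k *_) (moment-comm (m ++ mm) (m′ ++ mm)
          (ℕ.≤-trans (ℕ.≤-reflexive (List.length-++ m)) (ℕ.≤-trans (ℕ.+-monoˡ-≤ (length mm) len≤B) len≤D))
          (SameMonomial-++ʳ {m} {m′} mm m~m′))

      module _ (shift-symmetric : ShiftSymmetric μ) where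

        Ẽ-shiftP : ∀ t {p} → Bounded D p → Ẽ (shiftP t p) ≡ Ẽ p
        Ẽ-shiftP t {p} bp =
          trans (linExt-shiftP moment t p) (sym (linExt-cong (λ {m} len≤D → shift-symmetric m t len≤D) bp))

        Ẽ-var-uniform : 1 ≤ D → ∀ u a → Ẽ (var u a) ≡ Ẽ (var u zeroΣ)
        Ẽ-var-uniform 1≤D u a = begin
          Ẽ (var u a)        ≡⟨ Ẽ-shiftP a (Bounded-mono 1≤D (Bounded-var u a)) ⟨
          Ẽ (var u (a ⊝ a))  ≡⟨ cong (Ẽ ∘ var u) (inverseʳ a) ⟩
          Ẽ (var u zeroΣ)    ∎

        ∣Σ∣*marginal≡1 : 1 ≤ D → ∀ u → ∣Σ∣ * Ẽ (var u zeroΣ) ≡ 1#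
        ∣Σ∣*marginal≡1 1≤D u = begin
          ∣Σ∣ * Ẽ (var u zeroΣ)               ≡⟨ sumK-const (Ẽ-var-uniform 1≤D u) (allFin q) ⟨
          sumK (map (Ẽ ∘ var u) (allFin q))  ≡⟨ linExt-sumP moment (var u) (allFin q) ⟨
          Ẽ vars                              ≡⟨ x∙y⁻¹≈ε⇒x≈y (Ẽ vars) 1# complete-axiom ⟩
          1#                                  ∎
          where
          vars : Poly
          vars = sumP (map (var u) (allFin q))
          complete-axiom : Ẽ vars + - 1# ≡ 0#
          complete-axiom = begin
            Ẽ vars + - 1#              ≡⟨ cong (λ x → Ẽ vars + - x) normalized ⟨
            Ẽ vars + - Ẽ 1P            ≡⟨ cong (Ẽ vars +_) (linExt-negate moment 1P) ⟨
            Ẽ vars + Ẽ (-P 1P)         ≡⟨ linExt-++ moment vars (-P 1P) ⟨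
            Ẽ (vars +P (-P 1P))          ≡⟨ linExt-1P*P moment (vars +P (-P 1P)) ⟨
            Ẽ (1P *P (vars +P (-P 1P)))  ≡⟨ satisfies (complete u) 1P (Bounded⇒deg≤ (Bounded-mono 1≤D
                                            (Bounded-*P {B = 0} (z≤n ∷ [])
                                              (++⁺ (Bounded-sumP (Bounded-var u) (allFin q)) (z≤n ∷ []))))) ⟩
            0#                         ∎

        Ẽ-*P-pair-shift : ∀ {B f} → B +ℕ 2 ≤ D → Bounded B f → ShiftInvariant f → ∀ u v s a →
          Ẽ (f *P (var u a *P var v (a ⊕ s))) ≡ Ẽ (f *P (var u zeroΣ *P var v s))
        Ẽ-*P-pair-shift {B} {f} len≤D bf f-inv u v s a = begin
          Ẽ (f *P pair)
            ≡⟨ Ẽ-shiftP a (Bounded-mono len≤D (Bounded-*P bf (Bounded-*P (Bounded-var u a) (Bounded-var v (a ⊕ s))))) ⟨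
          Ẽ (shiftP a (f *P pair))               ≡⟨ cong Ẽ (shiftP-*P a f pair) ⟩
          Ẽ (shiftP a f *P shiftP a pair)        ≡⟨ cong (λ g → Ẽ (shiftP a f *P g)) pair-shifts ⟩
          Ẽ (shiftP a f *P (var u zeroΣ *P var v s))
            ≡⟨ Ẽ-*P-term-cong (1# * 1#) ((u , zeroΣ) ∷ (v , s) ∷ []) len≤D
                 (Bounded-shiftP a bf) bf (λ m → sym (f-inv a m)) ⟩
          Ẽ (f *P (var u zeroΣ *P var v s))      ∎
          where
          pair : Poly
          pair = var u a *P var v (a ⊕ s)
          pair-shifts : shiftP a pair ≡ var u zeroΣ *P var v s
          pair-shifts = cong₂ (λ b b′ → var u b *P var v b′) (inverseʳ a) (xyx⁻¹≈y a s)

        Ẽ-*P-indDiff : ∀ {B f} → B +ℕ 2 ≤ D → Bounded B f → ShiftInvariant f → ∀ u v s →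
          Ẽ (f *P indDiff v u s) ≡ ∣Σ∣ * Ẽ (f *P (ind u zeroΣ *P ind v s))
        Ẽ-*P-indDiff {f = f} len≤D bf f-inv u v s =
          trans (linExt-*P-sumP moment f (λ a → var u a *P var v (a ⊕ s)) (allFin q))
                (sumK-const (Ẽ-*P-pair-shift len≤D bf f-inv u v s) (allFin q))

        Pr-indDiff : 2 ≤ D → ∀ u v s → Pr μ (indDiff v u s) ≡ ∣Σ∣ * Ẽ (ind u zeroΣ *P ind v s)
        Pr-indDiff 2≤D u v s = begin
          Ẽ (indDiff v u s)                           ≡⟨ linExt-1P*P moment (indDiff v u s) ⟨
          Ẽ (1P *P indDiff v u s)                     ≡⟨ Ẽ-*P-indDiff {B = 0} 2≤D (z≤n ∷ []) (λ _ _ → refl) u v s ⟩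
          ∣Σ∣ * Ẽ (1P *P (ind u zeroΣ *P ind v s))    ≡⟨ cong (∣Σ∣ *_) (linExt-1P*P moment (ind u zeroΣ *P ind v s)) ⟩
          ∣Σ∣ * Ẽ (ind u zeroΣ *P ind v s)            ∎

        Pr-given-origin≡Pr-difference : 2 ≤ D → ∀ u v s →
          Pr[_∣_] μ (ind v s) (ind u zeroΣ) ≡ Pr μ (indDiff v u s)
        Pr-given-origin≡Pr-difference 2≤D u v s = begin
          Ẽ (ind v s *P ind u zeroΣ) * Ẽ (ind u zeroΣ) ⁻¹
            ≡⟨ cong₂ _*_ pair-comm (⁻¹-unique (trans (*-comm _ ∣Σ∣) (∣Σ∣*marginal≡1 (ℕ.<⇒≤ 2≤D) u))) ⟩
          Ẽ (ind u zeroΣ *P ind v s) * ∣Σ∣   ≡⟨ *-comm _ ∣Σ∣ ⟩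
          ∣Σ∣ * Ẽ (ind u zeroΣ *P ind v s)   ≡⟨ Pr-indDiff 2≤D u v s ⟨
          Pr μ (indDiff v u s)               ∎
          where
          pair-comm : Ẽ (ind v s *P ind u zeroΣ) ≡ Ẽ (ind u zeroΣ *P ind v s)
          pair-comm = cong (λ x → 1# * 1# * x + 0#)
            (moment-comm _ _ 2≤D (SameMonomial-++-comm ((v , s) ∷ []) ((u , zeroΣ) ∷ [])))

        Ẽ-given-difference≡Ẽ-given-pair : ∀ f → deg f +ℕ 2 ≤ D → ShiftInvariant f → ∀ u v s →
          Ẽ[_∣_] μ f (indDiff v u s) ≡ Ẽ[_∣_] μ f (ind u zeroΣ *P ind v s)
        Ẽ-given-difference≡Ẽ-given-pair f len≤D f-inv u v s = begin
          Ẽ (f *P indDiff v u s) * Pr μ (indDiff v u s) ⁻¹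
            ≡⟨ cong₂ (λ x y → x * y ⁻¹) (Ẽ-*P-indDiff len≤D (deg≤⇒Bounded f ℕ.≤-refl) f-inv u v s)
                                        (Pr-indDiff 2≤D u v s) ⟩
          (∣Σ∣ * Ẽ (f *P pair)) * (∣Σ∣ * Ẽ pair) ⁻¹
            ≡⟨ ratio-cancelˡ _ _ (∣Σ∣*marginal≡1 (ℕ.<⇒≤ 2≤D) u) ⟩
          Ẽ (f *P pair) * Ẽ pair ⁻¹                        ∎
          where
          pair : Poly
          pair = ind u zeroΣ *P ind v s
          2≤D : 2 ≤ D
          2≤D = ℕ.≤-trans (ℕ.m≤n+m 2 (deg f)) len≤D

open import Data.Nat using (_+_)

lemma3p9 : (F : OrderedField) (Σg : FiniteAbelianGroup) (n : ℕ)
    (I : AffineUG Σg n) (D : ℕ) → 2 ≤ D →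
    (μ : UG.PseudoExpectation F Σg n D) → UG.ShiftSymmetric F Σg n μ →
    (∀ (u v : Fin n) (s : Fin (FiniteAbelianGroup.q Σg)) →
      UG.Pr[_∣_] F Σg n μ (UG.ind F Σg n v s) (UG.ind F Σg n u (FiniteAbelianGroup.zeroΣ Σg))
        ≡ UG.Pr F Σg n μ (UG.indDiff F Σg n v u s))
    × (∀ (f : UG.Poly F Σg n) → UG.deg F Σg n f + 2 ≤ D →
      (∀ (t : Fin (FiniteAbelianGroup.q Σg)) → UG._≈P_ F Σg n f (UG.shiftP F Σg n t f)) →
      ∀ (u v : Fin n) (s : Fin (FiniteAbelianGroup.q Σg)) →
        UG.Ẽ[_∣_] F Σg n μ f (UG.indDiff F Σg n v u s)
          ≡ UG.Ẽ[_∣_] F Σg n μ f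
              (UG._*P_ F Σg n (UG.ind F Σg n u (FiniteAbelianGroup.zeroΣ Σg)) (UG.ind F Σg n v s)))
lemma3p9 F Σg n _ D 2≤D μ shift-symmetric =
  Pr-given-origin≡Pr-difference F Σg n μ shift-symmetric 2≤D ,
  Ẽ-given-difference≡Ẽ-given-pair F Σg n μ shift-symmetric
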